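{- Let $(G,s,t)$ be a Shannon game and let $\{a,b\}$ be a short-cut in it, where $b$ is a vertex of degree 2 adjacent to one terminal and at distance 2 from the other terminal, and $a$ is the other vertex of the pair. Suppose that one of the following holds: (i) $(G,s,t)$ is a minimal weak link or a minimal strong link (with either player to move first); (ii) $(G,s,t)$ is a weak link and Short moves first; (iii) one of the two players has a winning strategy for $(G,s,t)$ as second player. Then shorting $a$ and cutting $b$ (with the same player to move next as in the original game) does not change which player wins.
   Context: A Shannon game (link) $(G,s,t)$ consists of a finite simple graph $G$ and two distinct designated vertices $s,t$, the terminals. Two players, Short and Cut, alternately select a not-yet-selected non-terminal vertex; Short claims ("shorts") his vertices, Cut deletes ("cuts") his. Shorting $v$ is equivalent to deleting $v$ and making all pairs of former neighbours of $v$ adjacent; cutting $v$ is deleting $v$. Short wins if at the end there is an $s$–$t$ path all of whose internal vertices are claimed by Short; otherwise Cut wins. The link is strong if Short has a winning strategy when moving second, and weak if Short has a winning strategy when moving first but not when moving second. A weak link is minimal if deleting any single edge produces a game in which Short has no winning strategy as first player; a strong link is minimal if deleting any single edge produces a game that is not a strong link. A short-cut is a pair of adjacent non-terminal vertices, one of which has degree 2, is adjacent to one terminal and is at distance 2 from the other terminal. (When both vertices of the short-cut have degree 2 and satisfy this condition, either may play the role of $b$.) -}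

module Defs where

open import Data.Nat using (ℕ; zero; suc)
open import Data.Fin using (Fin)
open import Data.Fin.Properties using (_≟_)
open import Data.Bool using (Bool; true; false; _∧_; _∨_; not; if_then_else_)
open import Data.Bool.Properties using (∧-comm; ∨-comm; ∧-zeroʳ)
open import Data.List using (List; map; allFin)
open import Data.Nat.ListAction using (sum)
open import Data.Product using (Σ; _×_; _,_; ∃; ∃-syntax)
open import Data.Sum using (_⊎_)
open import Relation.Nullary using (¬_; does)
open import Relation.Binary.PropositionalEquality using (_≡_; _≢_; refl; cong; cong₂)

record Graph (n : ℕ) : Set where
  field
    E      : Fin n → Fin n → Bool
    sym    : ∀ x y → E x y ≡ E y x
    irrefl : ∀ x → E x x ≡ false
open Graph public

_=ᵇ_ : ∀ {n} → Fin n → Fin n → Bool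
x =ᵇ y = does (x ≟ y)

deg : ∀ {n} → Graph n → Fin n → ℕ
deg {n} G v = sum (map (λ w → if E G v w then 1 else 0) (allFin n))

Dist2 : ∀ {n} → Graph n → Fin n → Fin n → Set
Dist2 G x y = x ≢ y × E G x y ≡ false × ∃[ w ] (E G x w ≡ true × E G w y ≡ true)

private
  isUV : ∀ {n} → Fin n → Fin n → Fin n → Fin n → Bool
  isUV u v x y = (x =ᵇ u ∧ y =ᵇ v) ∨ (x =ᵇ v ∧ y =ᵇ u)

  isUV-sym : ∀ {n} (u v x y : Fin n) → isUV u v x y ≡ isUV u v y x
  isUV-sym u v x y =
    trans' (∨-comm (x =ᵇ u ∧ y =ᵇ v) (x =ᵇ v ∧ y =ᵇ u))
           (cong₂ _∨_ (∧-comm (x =ᵇ v) (y =ᵇ u)) (∧-comm (x =ᵇ u) (y =ᵇ v)))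
    where
    trans' : ∀ {a b c : Bool} → a ≡ b → b ≡ c → a ≡ c
    trans' refl q = q

deleteEdge : ∀ {n} → Graph n → Fin n → Fin n → Graph n
deleteEdge G u v = record
  { E      = λ x y → E G x y ∧ not (isUV u v x y)
  ; sym    = λ x y → cong₂ (λ p q → p ∧ not q) (sym G x y) (isUV-sym u v x y)
  ; irrefl = λ x → cong (λ p → p ∧ not (isUV u v x x)) (irrefl G x)
  }

data Player : Set where
  short cut : Player

other : Player → Player
other short = cut
other cut   = short

data Status : Set where
  free shorted cutv : Status

State : ℕ → Set
State n = Fin n → Status

mark : Player → Status
mark short = shorted
mark cut   = cutv

_[_↦_] : ∀ {n} → State n → Fin n → Status → State n
(σ [ v ↦ x ]) w = if w =ᵇ v then x else σ w

play : ∀ {n} → Player → Fin n → State n → State n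
play p v σ = σ [ v ↦ mark p ]

initial : ∀ {n} → State n
initial _ = free

module Game {n : ℕ} (G : Graph n) (s t : Fin n) where

  NonTerminal : Fin n → Set
  NonTerminal v = v ≢ s × v ≢ t

  Move : State n → Fin n → Set
  Move σ v = NonTerminal v × σ v ≡ free

  Finished : State n → Set
  Finished σ = ∀ v → ¬ Move σ v

  data Conn (σ : State n) : Fin n → Set where
    here : Conn σ s
    step : ∀ {u v} → Conn σ u → (u ≡ s ⊎ σ u ≡ shorted) → E G u v ≡ true → Conn σ v

  Outcome : Player → State n → Set
  Outcome short σ = Conn σ t
  Outcome cut   σ = ¬ Conn σ t

  -- Wins w p σ : player w has a winning strategy from state σ
  -- when player p is to move.
  data Wins (w : Player) : Player → State n → Set where
    done   : ∀ {p σ} → Finished σ → Outcome w σ → Wins w p σ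
    mine   : ∀ {σ} v → Move σ v → Wins w (other w) (play w v σ) → Wins w w σ
    theirs : ∀ {σ} → (∃[ v ] Move σ v)
           → (∀ v → Move σ v → Wins w w (play (other w) v σ))
           → Wins w (other w) σ

open Game public using (NonTerminal; Wins)

WeakLink : ∀ {n} → Graph n → Fin n → Fin n → Set
WeakLink G s t = Wins G s t short short initial × ¬ Wins G s t short cut initial

StrongLink : ∀ {n} → Graph n → Fin n → Fin n → Set
StrongLink G s t = Wins G s t short cut initial

MinimalWeakLink : ∀ {n} → Graph n → Fin n → Fin n → Set
MinimalWeakLink G s t = WeakLink G s t ×
  (∀ u v → E G u v ≡ true → ¬ Wins (deleteEdge G u v) s t short short initial)

MinimalStrongLink : ∀ {n} → Graph n → Fin n → Fin n → Set
MinimalStrongLink G s t = StrongLink G s t ×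
  (∀ u v → E G u v ≡ true → ¬ StrongLink (deleteEdge G u v) s t)

SecondPlayerWins : ∀ {n} → Graph n → Fin n → Fin n → Set
SecondPlayerWins G s t = Wins G s t short cut initial ⊎ Wins G s t cut short initial

ShortCut : ∀ {n} → Graph n → Fin n → Fin n → Fin n → Fin n → Set
ShortCut G s t a b =
  NonTerminal G s t a × NonTerminal G s t b × E G a b ≡ true × deg G b ≡ 2 ×
  ((E G b s ≡ true × Dist2 G b t) ⊎ (E G b t ≡ true × Dist2 G b s))

reduced : ∀ {n} → Fin n → Fin n → State n
reduced a b = (initial [ a ↦ shorted ]) [ b ↦ cutv ]

-- Write R for the position in which a is shorted and b is cut. Any winning strategy of Cut from R
-- also wins from the original position by pairing: whenever Short takes a or b, Cut takes the other.
-- Taking b is harmless for Short since R is reached; taking a is harmless since, with a cut, b can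
-- only be entered and left through its terminal neighbour and so is useless to Short. By determinacy,
-- R is therefore never worse for Short. When Short moves first the converse holds as well: Short opens
-- with a, and unless Cut answers with b (reaching R) Short shorts b, and a, b join s and t.
-- When Cut moves first he may take a himself, and the converse comes from the hypotheses: it is
-- trivial if Short wins the original game as second player; if Cut does, a Short win from R with Cut
-- to move would give one with Short to move, hence one in the original game; and for a minimal weak
-- link, Short winning from R would let him win the game without the edge ab by opening with a.
-- For Cut the statement follows from the one for Short by determinacy.

module Submission where

open import Defs
open import Data.Fin using (Fin)
open import Data.Product using (_×_)
open import Data.Sum using (_⊎_)
open import Function.Bundles using (_⇔_; mk⇔; Equivalence)
open import Relation.Binary.PropositionalEquality using (_≡_; _≢_)

open import Data.Bool using (Bool; true; false; if_then_else_)
import Data.Bool as Bool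
open import Data.Empty using (⊥; ⊥-elim)
open import Data.Fin using (zero; suc)
open import Data.Fin.Properties using (_≟_; any?)
open import Data.Fin.Subset using (Subset; _∈_; _∉_; ∣_∣; ⁅_⁆; ∁; _-_)
open import Data.Fin.Subset.Properties
  using (_∈?_; p⊂q⇒∣p∣<∣q∣; x∈p⇒∣p-x∣<∣p∣; x∈p∧x≢y⇒x∈p-y; p─q⊆p; x∈⁅x⁆; x∈⁅y⁆⇒x≡y; x∈p⇒x∉∁p; x∉∁p⇒x∈p)
open import Data.List using (allFin; map)
open import Data.List.Properties using (map-tabulate)
open import Data.Nat using (ℕ; zero; suc; _<_; z≤n)
open import Data.Nat.Induction using (<-wellFounded)
open import Data.Nat.ListAction using (sum)
open import Data.Nat.Properties using (≤-<-trans; <-irrefl)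
open import Data.Product using (Σ; ∃; ∃₂; _,_; proj₁; proj₂)
open import Data.Sum using (inj₁; inj₂; swap)
import Data.Sum as Sum
open import Data.Vec using (tabulate)
open import Data.Vec.Properties using (lookup∘tabulate; []=⇒lookup; lookup⇒[]=)
open import Function using (_∘_; _on_; id)
open import Induction.WellFounded using (WellFounded; Acc; acc)
open import Relation.Binary using (Decidable; DecidableEquality)
import Relation.Binary.Construct.On as On
open import Relation.Binary.PropositionalEquality using (refl; trans; subst)
import Relation.Binary.PropositionalEquality as ≡
open import Relation.Nullary using (¬_; Dec; yes; no; does; ¬?; _×-dec_)
open import Relation.Nullary.Decidable using (dec-true; dec-false; map′; _⊎-dec_)

open Game using (done; mine; theirs)

_≟ˢ_ : DecidableEquality Status
free    ≟ˢ free    = yes refl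
shorted ≟ˢ shorted = yes refl
cutv    ≟ˢ cutv    = yes refl
free    ≟ˢ shorted = no λ ()
free    ≟ˢ cutv    = no λ ()
shorted ≟ˢ free    = no λ ()
shorted ≟ˢ cutv    = no λ ()
cutv    ≟ˢ free    = no λ ()
cutv    ≟ˢ shorted = no λ ()

mark≢free : ∀ p → mark p ≢ free
mark≢free short ()
mark≢free cut   ()

other-involutive : ∀ p → other (other p) ≡ p
other-involutive short = refl
other-involutive cut   = refl

search : ∀ {n} {A B : Fin n → Set} → (∀ v → A v ⊎ B v) → ∃ A ⊎ (∀ v → B v)
search {zero}  f = inj₂ λ ()
search {suc n} f with f zero | search (f ∘ suc)
... | inj₁ a | _            = inj₁ (zero , a)
... | inj₂ _ | inj₁ (v , a) = inj₁ (suc v , a)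
... | inj₂ b | inj₂ g       = inj₂ λ { zero → b ; (suc v) → g v }

module _ {n : ℕ} where

  [↦]-same : ∀ (σ : State n) v x → (σ [ v ↦ x ]) v ≡ x
  [↦]-same σ v x rewrite dec-true (v ≟ v) refl = refl

  [↦]-other : ∀ (σ : State n) {v w} x → w ≢ v → (σ [ v ↦ x ]) w ≡ σ w
  [↦]-other σ {v} {w} x w≢v rewrite dec-false (w ≟ v) w≢v = refl

  [↦]-other² : ∀ (σ : State n) {u u′ v} x y → v ≢ u → v ≢ u′ → ((σ [ u ↦ x ]) [ u′ ↦ y ]) v ≡ σ v
  [↦]-other² σ x y v≢u v≢u′ = trans ([↦]-other (σ [ _ ↦ x ]) y v≢u′) ([↦]-other σ x v≢u)

  [↦]-self : ∀ (σ : State n) v w → (σ [ v ↦ σ v ]) w ≡ σ w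
  [↦]-self σ v w with w ≟ v
  ... | yes refl = refl
  ... | no _     = refl

  [↦]-taken : ∀ (σ : State n) {u v} x → σ u ≡ free → σ v ≢ free → (σ [ u ↦ x ]) v ≡ σ v
  [↦]-taken σ {u} {v} x σu≡free σv≢free with v ≟ u
  ... | yes refl = ⊥-elim (σv≢free σu≡free)
  ... | no _     = refl

  [↦]-cong : ∀ (σ τ : State n) {u v} x → σ v ≡ τ v → (σ [ u ↦ x ]) v ≡ (τ [ u ↦ x ]) v
  [↦]-cong σ τ {u} {v} x σv≡τv with v ≟ u
  ... | yes _ = refl
  ... | no _  = σv≡τv

  [↦]-elim : ∀ (P : Status → Set) (σ : State n) {u v x} → P x → P (σ v) → P ((σ [ u ↦ x ]) v)
  [↦]-elim P σ {u} {v} px pv with v ≟ u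
  ... | yes _ = px
  ... | no _  = pv

  freeVertices : State n → Subset n
  freeVertices σ = tabulate (λ v → does (σ v ≟ˢ free))

  ∈-freeVertices⁺ : ∀ σ {v} → σ v ≡ free → v ∈ freeVertices σ
  ∈-freeVertices⁺ σ {v} σv≡free =
    lookup⇒[]= v _ (trans (lookup∘tabulate _ v) (dec-true (σ v ≟ˢ free) σv≡free))

  ∈-freeVertices⁻ : ∀ σ {v} → v ∈ freeVertices σ → σ v ≡ free
  ∈-freeVertices⁻ σ {v} v∈ with σ v ≟ˢ free | trans (≡.sym (lookup∘tabulate _ v)) ([]=⇒lookup v∈)
  ... | yes σv≡free | _ = σv≡free
  ... | no _        | ()

  infix 4 _≺_
  _≺_ : State n → State n → Set
  _≺_ = _<_ on (∣_∣ ∘ freeVertices)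

  ≺-wellFounded : WellFounded _≺_
  ≺-wellFounded = On.wellFounded (∣_∣ ∘ freeVertices) <-wellFounded

  [↦]-≺ : ∀ (σ : State n) {v x} → σ v ≡ free → x ≢ free → σ [ v ↦ x ] ≺ σ
  [↦]-≺ σ {v} {x} σv≡free x≢free = p⊂q⇒∣p∣<∣q∣ (fewer , v , ∈-freeVertices⁺ σ σv≡free , v-taken)
    where
    v-taken : v ∉ freeVertices (σ [ v ↦ x ])
    v-taken v∈ = x≢free (trans (≡.sym ([↦]-same σ v x)) (∈-freeVertices⁻ (σ [ v ↦ x ]) v∈))
    fewer : ∀ {w} → w ∈ freeVertices (σ [ v ↦ x ]) → w ∈ freeVertices σ
    fewer {w} w∈ with w ≟ v
    ... | yes refl = ⊥-elim (v-taken w∈)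
    ... | no w≢v   = ∈-freeVertices⁺ σ (trans (≡.sym ([↦]-other σ x w≢v)) (∈-freeVertices⁻ (σ [ v ↦ x ]) w∈))

module Reachability {n : ℕ} (_⟶_ : Fin n → Fin n → Set) (_⟶?_ : Decidable _⟶_) (s : Fin n) where

  infixl 5 _▸_
  data Reachable : Fin n → Set where
    start : Reachable s
    _▸_   : ∀ {u v} → Reachable u → u ⟶ v → Reachable v

  -- The search keeps the set U of vertices not yet known to be reachable.
  private
    Sound : Subset n → Set
    Sound U = ∀ {v} → v ∉ U → Reachable v

    Closed : Subset n → Set
    Closed U = ∀ {u v} → u ∉ U → u ⟶ v → v ∉ U

    Exit : Subset n → Set
    Exit U = ∃₂ λ u v → u ∉ U × u ⟶ v × v ∈ U

    exit? : ∀ U → Dec (Exit U)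
    exit? U = any? λ u → any? λ v → ¬? (u ∈? U) ×-dec u ⟶? v ×-dec v ∈? U

    saturate : ∀ U → Acc (_<_ on ∣_∣) U → s ∉ U → Sound U → Σ (Subset n) λ U → s ∉ U × Sound U × Closed U
    saturate U (acc smaller) s∉U sound with exit? U
    ... | no no-exit = U , s∉U , sound , closed
      where
      closed : Closed U
      closed {u} {v} u∉U u⟶v v∈U = no-exit (u , v , u∉U , u⟶v , v∈U)
    ... | yes (u , v , u∉U , u⟶v , v∈U) =
      saturate (U - v) (smaller (x∈p⇒∣p-x∣<∣p∣ v∈U)) (s∉U ∘ p─q⊆p U ⁅ v ⁆) sound′
      where
      sound′ : Sound (U - v)
      sound′ {w} w∉U-v with w ≟ v | w ∈? U
      ... | yes refl | _      = sound u∉U ▸ u⟶v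
      ... | no w≢v   | yes w∈U = ⊥-elim (w∉U-v (x∈p∧x≢y⇒x∈p-y w∈U w≢v))
      ... | no _     | no w∉U  = sound w∉U

    complete : ∀ {U v} → s ∉ U → Closed U → Reachable v → v ∉ U
    complete s∉U closed start       = s∉U
    complete s∉U closed (r ▸ u⟶v) = closed (complete s∉U closed r) u⟶v

    saturated : Σ (Subset n) λ U → s ∉ U × Sound U × Closed U
    saturated = saturate (∁ ⁅ s ⁆) (On.wellFounded ∣_∣ <-wellFounded _) (x∈p⇒x∉∁p (x∈⁅x⁆ s)) only-s-reached
      where
      only-s-reached : Sound (∁ ⁅ s ⁆)
      only-s-reached v∉ with x∈⁅y⁆⇒x≡y s (x∉∁p⇒x∈p v∉)
      ... | refl = start

  reachable? : ∀ v → Dec (Reachable v)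
  reachable? v with saturated | v ∈? proj₁ saturated
  ... | U , s∉U , sound , closed | yes v∈U = no λ r → complete s∉U closed r v∈U
  ... | U , s∉U , sound , closed | no v∉U  = yes (sound v∉U)

sum-indicators≡∣tabulate∣ : ∀ {n} (f : Fin n → Bool) → sum (map (λ v → if f v then 1 else 0) (allFin n)) ≡ ∣ tabulate f ∣
sum-indicators≡∣tabulate∣ {zero}  f = refl
sum-indicators≡∣tabulate∣ {suc n} f
  rewrite map-tabulate suc (λ v → if f v then 1 else 0)
        | ≡.sym (map-tabulate (λ v → v) (λ v → if f (suc v) then 1 else 0))
        | sum-indicators≡∣tabulate∣ (f ∘ suc)
  with f zero
... | true  = refl
... | false = refl

E-sym : ∀ {n} (G : Graph n) {u v} → E G u v ≡ true → E G v u ≡ true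
E-sym G {u} {v} = trans (sym G v u)

E⇒≢ : ∀ {n} (G : Graph n) {u v} → E G u v ≡ true → u ≢ v
E⇒≢ G {u} e refl with trans (≡.sym (irrefl G u)) e
... | ()

neighbourhood : ∀ {n} → Graph n → Fin n → Subset n
neighbourhood G v = tabulate (E G v)

∈-neighbourhood : ∀ {n} (G : Graph n) {v w} → E G v w ≡ true → w ∈ neighbourhood G v
∈-neighbourhood G {v} {w} e = lookup⇒[]= w _ (trans (lookup∘tabulate (E G v) w) e)

deg≡∣neighbourhood∣ : ∀ {n} (G : Graph n) v → deg G v ≡ ∣ neighbourhood G v ∣
deg≡∣neighbourhood∣ G v = sum-indicators≡∣tabulate∣ (E G v)

deg-2-neighbours : ∀ {n} (G : Graph n) {b y z} → deg G b ≡ 2 → E G b y ≡ true → E G b z ≡ true → y ≢ z →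
                   ∀ {v} → E G b v ≡ true → v ≡ y ⊎ v ≡ z
deg-2-neighbours G {b} {y} {z} deg≡2 E-by E-bz y≢z {v} E-bv with v ≟ y | v ≟ z
... | yes v≡y | _        = inj₁ v≡y
... | no _    | yes v≡z  = inj₂ v≡z
... | no v≢y  | no v≢z   = ⊥-elim (<-irrefl refl (subst (2 <_) ∣N∣≡2 2<∣N∣))
  where
  N : Subset _
  N = neighbourhood G b
  ∣N∣≡2 : ∣ N ∣ ≡ 2
  ∣N∣≡2 = trans (≡.sym (deg≡∣neighbourhood∣ G b)) deg≡2
  z∈N-y : z ∈ N - y
  z∈N-y = x∈p∧x≢y⇒x∈p-y (∈-neighbourhood G E-bz) (y≢z ∘ ≡.sym)
  v∈N-y-z : v ∈ N - y - z
  v∈N-y-z = x∈p∧x≢y⇒x∈p-y (x∈p∧x≢y⇒x∈p-y (∈-neighbourhood G E-bv) v≢y) v≢z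
  2<∣N∣ : 2 < ∣ N ∣
  2<∣N∣ = ≤-<-trans (≤-<-trans (≤-<-trans z≤n (x∈p⇒∣p-x∣<∣p∣ v∈N-y-z)) (x∈p⇒∣p-x∣<∣p∣ z∈N-y))
                    (x∈p⇒∣p-x∣<∣p∣ (∈-neighbourhood G E-by))

module Play {n : ℕ} (G : Graph n) (s t : Fin n) where
  open Game G s t public hiding (Wins; NonTerminal; done; mine; theirs)

  move? : ∀ σ v → Dec (Move σ v)
  move? σ v = (¬? (v ≟ s) ×-dec ¬? (v ≟ t)) ×-dec σ v ≟ˢ free

  move-or-finished : ∀ σ → ∃ (Move σ) ⊎ Finished σ
  move-or-finished σ with any? (move? σ)
  ... | yes some-move = inj₁ some-move
  ... | no no-move    = inj₂ λ v mv → no-move (v , mv)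

  Conn-mono : ∀ {σ ρ} → (∀ v → σ v ≡ shorted → ρ v ≡ shorted) → ∀ {v} → Conn σ v → Conn ρ v
  Conn-mono keep here                   = here
  Conn-mono keep (step c (inj₁ u≡s) e)  = step (Conn-mono keep c) (inj₁ u≡s) e
  Conn-mono keep (step c (inj₂ σu≡s) e) = step (Conn-mono keep c) (inj₂ (keep _ σu≡s)) e

  Conn-play : ∀ {σ p u} → σ u ≡ free → ∀ {v} → Conn σ v → Conn (play p u σ) v
  Conn-play {σ} {p} σu≡free =
    Conn-mono λ v σv≡s → trans ([↦]-taken σ (mark p) σu≡free (mark≢free short ∘ trans (≡.sym σv≡s))) σv≡s

  conn? : ∀ σ v → Dec (Conn σ v)
  conn? σ v = map′ to from (R.reachable? v)
    where
    module R = Reachability (λ u v → (u ≡ s ⊎ σ u ≡ shorted) × E G u v ≡ true)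
                            (λ u v → ((u ≟ s) ⊎-dec (σ u ≟ˢ shorted)) ×-dec (E G u v Bool.≟ true)) s
    to : ∀ {v} → R.Reachable v → Conn σ v
    to R.start            = here
    to (r R.▸ (ok , e)) = step (to r) ok e
    from : ∀ {v} → Conn σ v → R.Reachable v
    from here           = R.start
    from (step c ok e) = from c R.▸ (ok , e)

  outcome? : ∀ p σ → Outcome p σ ⊎ Outcome (other p) σ
  outcome? short σ with conn? σ t
  ... | yes c = inj₁ c
  ... | no ¬c = inj₂ ¬c
  outcome? cut σ with conn? σ t
  ... | yes c = inj₂ c
  ... | no ¬c = inj₁ ¬c

  opponent-wins : ∀ {p σ} → ∃ (Move σ) → (∀ v → Move σ v → Wins G s t (other p) (other p) (play p v σ)) →
                  Wins G s t (other p) p σ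
  opponent-wins {short} = theirs
  opponent-wins {cut}   = theirs

  mover-or-opponent-wins : ∀ p σ → Acc _≺_ σ → Wins G s t p p σ ⊎ Wins G s t (other p) p σ
  mover-or-opponent-wins p σ (acc smaller) with move-or-finished σ
  ... | inj₂ finished  = Sum.map (done finished) (done finished) (outcome? p σ)
  ... | inj₁ some-move = Sum.map (λ (v , mv , d) → mine v mv d) (opponent-wins some-move) (search reply)
    where
    reply : ∀ v → (Move σ v × Wins G s t p (other p) (play p v σ)) ⊎ (Move σ v → Wins G s t (other p) (other p) (play p v σ))
    reply v with move? σ v
    ... | no ¬mv = inj₂ (⊥-elim ∘ ¬mv)
    ... | yes mv with mover-or-opponent-wins (other p) (play p v σ) (smaller ([↦]-≺ σ (proj₂ mv) (mark≢free p)))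
    ...   | inj₁ d = inj₂ λ _ → d
    ...   | inj₂ d = inj₁ (mv , subst (λ q → Wins G s t q (other p) (play p v σ)) (other-involutive p) d)

  short-or-cut : ∀ p σ → Wins G s t short p σ ⊎ Wins G s t cut p σ
  short-or-cut short σ = mover-or-opponent-wins short σ (≺-wellFounded σ)
  short-or-cut cut   σ = swap (mover-or-opponent-wins cut σ (≺-wellFounded σ))

  outcome-of-finished : ∀ {w p σ} → Finished σ → Wins G s t w p σ → Outcome w σ
  outcome-of-finished finished (done _ o)          = o
  outcome-of-finished finished (mine v mv _)       = ⊥-elim (finished v mv)
  outcome-of-finished finished (theirs (v , mv) _) = ⊥-elim (finished v mv)

  ¬both-win : ∀ {p σ} → Wins G s t short p σ → Wins G s t cut p σ → ⊥
  ¬both-win (done f c)          d                  = outcome-of-finished f d c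
  ¬both-win (mine v mv _)       (done f _)         = f v mv
  ¬both-win (mine v mv d)       (theirs _ g)       = ¬both-win d (g v mv)
  ¬both-win (theirs (v , mv) _) (done f _)         = f v mv
  ¬both-win (theirs _ g)        (mine v mv d)      = ¬both-win (g v mv) d

  cut-wins : ∀ {p σ} → ¬ Wins G s t short p σ → Wins G s t cut p σ
  cut-wins {p} {σ} ¬short = Sum.[ ⊥-elim ∘ ¬short , id ]′ (short-or-cut p σ)

  ⇔-for-cut : ∀ {p σ τ} → Wins G s t short p σ ⇔ Wins G s t short p τ → Wins G s t cut p σ ⇔ Wins G s t cut p τ
  ⇔-for-cut e = mk⇔ (λ c → cut-wins λ d → ¬both-win (Equivalence.from e d) c)
                    (λ c → cut-wins λ d → ¬both-win (Equivalence.to e d) c)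

  connected⇒¬cut-wins : ∀ {p σ} → Conn σ t → ¬ Wins G s t cut p σ
  connected⇒¬cut-wins c (done _ ¬c)         = ¬c c
  connected⇒¬cut-wins c (mine v mv d)       = connected⇒¬cut-wins (Conn-play (proj₂ mv) c) d
  connected⇒¬cut-wins c (theirs (v , mv) g) = connected⇒¬cut-wins (Conn-play (proj₂ mv) c) (g v mv)

  connected⇒short-wins : ∀ {p σ} → Conn σ t → Wins G s t short p σ
  connected⇒short-wins {p} {σ} c = Sum.[ id , ⊥-elim ∘ connected⇒¬cut-wins c ]′ (short-or-cut p σ)

infix 4 _≼⟨_⟩_
data _≼⟨_⟩_ (x : Status) (w : Player) (y : Status) : Set where
  same : x ≡ y → x ≼⟨ w ⟩ y
  lost : x ≡ mark (other w) → x ≼⟨ w ⟩ y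
  won  : y ≡ mark w → x ≼⟨ w ⟩ y

≼-short : ∀ {x y} → x ≼⟨ short ⟩ y → x ≡ shorted → y ≡ shorted
≼-short (same refl) x≡s = x≡s
≼-short (lost refl) ()
≼-short (won y≡s)   _   = y≡s

≼-cut : ∀ {x y} → x ≼⟨ cut ⟩ y → y ≡ shorted → x ≡ shorted
≼-cut (same refl) y≡s = y≡s
≼-cut (lost x≡s)  _   = x≡s
≼-cut (won refl)  ()

infix 4 _⊑_
_⊑_ : ∀ {n} → State n → State n → Set
σ ⊑ τ = ∀ v → σ v ≢ free → τ v ≡ σ v

⊑-refl : ∀ {n} {σ : State n} → σ ⊑ σ
⊑-refl v _ = refl

⊑-play : ∀ {n} {σ₀ σ : State n} {u} p → σ₀ ⊑ σ → σ u ≡ free → σ₀ ⊑ play p u σ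
⊑-play {σ = σ} p σ₀⊑σ σu≡free v σ₀v≢free =
  trans ([↦]-taken σ (mark p) σu≡free (σ₀v≢free ∘ trans (≡.sym (σ₀⊑σ v σ₀v≢free)))) (σ₀⊑σ v σ₀v≢free)

mover : ∀ w p → p ≡ w ⊎ p ≡ other w
mover short short = inj₁ refl
mover short cut   = inj₂ refl
mover cut   short = inj₂ refl
mover cut   cut   = inj₁ refl

-- w copies a winning strategy from σ₀ in G₁ to ρ₀ in G₂, a position at least as good for w except at
-- Frozen vertices, which are taken in both. A move of the strategy at a vertex already w's in ρ is
-- replaced by an arbitrary free one, and an opponent move at a vertex already the opponent's in σ is
-- treated as the opponent having moved elsewhere.
module Simulation {n : ℕ} (G₁ G₂ : Graph n) (s t : Fin n) (w : Player) (Frozen : Fin n → Set)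
                  (σ₀ ρ₀ : State n) where
  private
    module A = Play G₁ s t
    module B = Play G₂ s t

  RelatedAt : Fin n → Status → Status → Set
  RelatedAt v x y = x ≼⟨ w ⟩ y ⊎ (Frozen v × x ≢ free × y ≢ free)

  Related : State n → State n → Set
  Related σ ρ = ∀ v → RelatedAt v (σ v) (ρ v)

  OutcomeTransfer : Set
  OutcomeTransfer = ∀ {σ ρ} → σ₀ ⊑ σ → ρ₀ ⊑ ρ → Related σ ρ → A.Outcome w σ → B.Outcome w ρ

  private
    free-left : ∀ {v x y} → RelatedAt v x y → x ≡ free → y ≢ free → y ≡ mark w
    free-left (inj₁ (same refl))        refl   y≢free = ⊥-elim (y≢free refl)
    free-left (inj₁ (lost x≡mark))      x≡free _      = ⊥-elim (mark≢free (other w) (trans (≡.sym x≡mark) x≡free))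
    free-left (inj₁ (won y≡mark))       _      _      = y≡mark
    free-left (inj₂ (_ , x≢free , _))  x≡free _      = ⊥-elim (x≢free x≡free)

    free-right : ∀ {v x y} → RelatedAt v x y → y ≡ free → x ≢ free → x ≡ mark (other w)
    free-right (inj₁ (same refl))        refl   x≢free = ⊥-elim (x≢free refl)
    free-right (inj₁ (lost x≡mark))      _      _      = x≡mark
    free-right (inj₁ (won y≡mark))       y≡free _      = ⊥-elim (mark≢free w (trans (≡.sym y≡mark) y≡free))
    free-right (inj₂ (_ , _ , y≢free))  y≡free _      = ⊥-elim (y≢free y≡free)

    related-[↦] : ∀ {σ ρ u x y} → Related σ ρ → RelatedAt u x y → Related (σ [ u ↦ x ]) (ρ [ u ↦ y ])
    related-[↦] {u = u} r ru v with v ≟ u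
    ... | yes refl = ru
    ... | no _     = r v

    related-[↦]ˡ : ∀ {σ ρ u x} → Related σ ρ → RelatedAt u x (ρ u) → Related (σ [ u ↦ x ]) ρ
    related-[↦]ˡ {ρ = ρ} {u} r ru v = subst (RelatedAt v _) ([↦]-self ρ u v) (related-[↦] r ru v)

    related-[↦]ʳ : ∀ {σ ρ u y} → Related σ ρ → RelatedAt u (σ u) y → Related σ (ρ [ u ↦ y ])
    related-[↦]ʳ {σ} {u = u} r ru v = subst (λ x → RelatedAt v x _) ([↦]-self σ u v) (related-[↦] r ru v)

  module _ (transfer : OutcomeTransfer) where
    private
      play-out : ∀ {p σ ρ} → σ₀ ⊑ σ → ρ₀ ⊑ ρ → Related σ ρ → B.Finished ρ → Wins G₁ s t w p σ → B.Outcome w ρ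
      play-out σ₀⊑σ ρ₀⊑ρ r _ (done _ o) = transfer σ₀⊑σ ρ₀⊑ρ r o
      play-out σ₀⊑σ ρ₀⊑ρ r fin (mine v (nt , σv≡free) d) =
        play-out (⊑-play w σ₀⊑σ σv≡free) ρ₀⊑ρ
                 (related-[↦]ˡ r (inj₁ (won (free-left (r v) σv≡free λ ρv≡free → fin v (nt , ρv≡free))))) fin d
      play-out σ₀⊑σ ρ₀⊑ρ r fin (theirs (z , mz) g) =
        play-out (⊑-play (other w) σ₀⊑σ (proj₂ mz)) ρ₀⊑ρ (related-[↦]ˡ r (inj₁ (lost refl))) fin (g z mz)

      sim : ∀ {p σ ρ} → Acc _≺_ ρ → σ₀ ⊑ σ → ρ₀ ⊑ ρ → Related σ ρ → Wins G₁ s t w p σ → Wins G₂ s t w p ρ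
      sim {σ = σ} {ρ} (acc smaller) σ₀⊑σ ρ₀⊑ρ r d with B.move-or-finished ρ
      ... | inj₂ fin      = done fin (play-out σ₀⊑σ ρ₀⊑ρ r fin d)
      ... | inj₁ (m , mm) = respond d
        where
        continue : ∀ {p σ′ q u} → B.Move ρ u → σ₀ ⊑ σ′ → Related σ′ (play q u ρ) →
                   Wins G₁ s t w p σ′ → Wins G₂ s t w p (play q u ρ)
        continue {q = q} (_ , ρu≡free) σ₀⊑σ′ =
          sim (smaller ([↦]-≺ ρ ρu≡free (mark≢free q))) σ₀⊑σ′ (⊑-play q ρ₀⊑ρ ρu≡free)

        respond : ∀ {p} → Wins G₁ s t w p σ → Wins G₂ s t w p ρ
        respond {p} (done f o) with mover w p
        ... | inj₁ refl = mine m mm (continue mm σ₀⊑σ (related-[↦]ʳ r (inj₁ (won refl))) (done f o))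
        ... | inj₂ refl = theirs (m , mm) λ x (nt , ρx≡free) →
          continue (nt , ρx≡free) σ₀⊑σ
                   (related-[↦]ʳ r (inj₁ (lost (free-right (r x) ρx≡free λ σx≡free → f x (nt , σx≡free)))))
                   (done f o)
        respond (mine v (nt , σv≡free) d′) with ρ v ≟ˢ free
        ... | yes ρv≡free = mine v (nt , ρv≡free)
          (continue (nt , ρv≡free) (⊑-play w σ₀⊑σ σv≡free) (related-[↦] r (inj₁ (same refl))) d′)
        ... | no ρv≢free = mine m mm
          (continue mm (⊑-play w σ₀⊑σ σv≡free)
                    (related-[↦]ʳ (related-[↦]ˡ r (inj₁ (won (free-left (r v) σv≡free ρv≢free)))) (inj₁ (won refl)))
                    d′)
        respond (theirs (z , mz) g) = theirs (m , mm) reply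
          where
          reply : ∀ x → B.Move ρ x → Wins G₂ s t w w (play (other w) x ρ)
          reply x mx with σ x ≟ˢ free
          ... | yes σx≡free = continue mx (⊑-play (other w) σ₀⊑σ σx≡free) (related-[↦] r (inj₁ (same refl)))
                                       (g x (proj₁ mx , σx≡free))
          ... | no σx≢free = continue mx (⊑-play (other w) σ₀⊑σ (proj₂ mz))
            (related-[↦]ʳ (related-[↦]ˡ r (inj₁ (lost refl)))
              (inj₁ (lost ([↦]-elim (_≡ mark (other w)) σ refl (free-right (r x) (proj₂ mx) σx≢free)))))
            (g z mz)

    simulate : ∀ {p} → Related σ₀ ρ₀ → Wins G₁ s t w p σ₀ → Wins G₂ s t w p ρ₀
    simulate = sim (≺-wellFounded ρ₀) ⊑-refl ⊑-refl

module _ {n : ℕ} {G : Graph n} {s t : Fin n} where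
  open Play G s t

  outcome-mono : ∀ w {σ ρ} → (∀ v → σ v ≼⟨ w ⟩ ρ v) → Outcome w σ → Outcome w ρ
  outcome-mono short σ≼ρ c    = Conn-mono (λ v → ≼-short (σ≼ρ v)) c
  outcome-mono cut   σ≼ρ ¬c c = ¬c (Conn-mono (λ v → ≼-cut (σ≼ρ v)) c)

  wins-mono : ∀ w {p σ ρ} → (∀ v → σ v ≼⟨ w ⟩ ρ v) → Wins G s t w p σ → Wins G s t w p ρ
  wins-mono w {σ = σ} {ρ} σ≼ρ = simulate transfer (inj₁ ∘ σ≼ρ)
    where
    open Simulation G G s t w (λ _ → ⊥) σ ρ
    transfer : OutcomeTransfer
    transfer _ _ r = outcome-mono w λ v → Sum.[ id , ⊥-elim ∘ proj₁ ]′ (r v)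

  wins-≗ : ∀ {w p σ ρ} → (∀ v → σ v ≡ ρ v) → Wins G s t w p σ → Wins G s t w p ρ
  wins-≗ {w} σ≗ρ = wins-mono w (same ∘ σ≗ρ)

  extra-move : ∀ {w σ} → Wins G s t w (other w) σ → Wins G s t w w σ
  extra-move {w} {σ} d with move-or-finished σ
  ... | inj₂ finished = done finished (outcome-of-finished finished d)
  ... | inj₁ (m , mm) = mine m mm (wins-mono w (λ v → [↦]-elim (σ v ≼⟨ w ⟩_) σ (won refl) (same refl)) d)

deleteEdge-keeps : ∀ {n} (G : Graph n) {a b u v} → u ≢ b → v ≢ b → E G u v ≡ true → E (deleteEdge G a b) u v ≡ true
deleteEdge-keeps G {a} {b} {u} {v} u≢b v≢b e rewrite e | dec-false (u ≟ b) u≢b | dec-false (v ≟ b) v≢b with u =ᵇ a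
... | true  = refl
... | false = refl

Conn-deleteEdge : ∀ {n} (G : Graph n) {s t a b σ} → b ≢ s → b ≢ t → σ b ≢ shorted →
                  Game.Conn G s t σ t → Game.Conn (deleteEdge G a b) s t σ t
Conn-deleteEdge G {s} {t} {a} {b} {σ} b≢s b≢t σb≢shorted c = Sum.[ id , (λ t≡b → ⊥-elim (b≢t (≡.sym t≡b))) ]′ (avoid c)
  where
  module G  = Game G s t
  module G∖ = Game (deleteEdge G a b) s t
  b-blocks : ¬ (b ≡ s ⊎ σ b ≡ shorted)
  b-blocks = Sum.[ b≢s , σb≢shorted ]′
  avoid : ∀ {v} → G.Conn σ v → G∖.Conn σ v ⊎ v ≡ b
  avoid G.here = inj₁ G∖.here
  avoid (G.step {u} {v} c ok e) with avoid c | v ≟ b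
  ... | inj₂ refl | _        = ⊥-elim (b-blocks ok)
  ... | inj₁ _    | yes v≡b  = inj₂ v≡b
  ... | inj₁ c′   | no v≢b   = inj₁ (G∖.step c′ ok (deleteEdge-keeps G (λ { refl → b-blocks ok }) v≢b e))

module ShortCutGame {n : ℕ} (G : Graph n) {s t a b : Fin n} (sc : ShortCut G s t a b) where
  open Play G s t

  private
    a-nonterminal : NonTerminal G s t a
    a-nonterminal = proj₁ sc
    b-nonterminal : NonTerminal G s t b
    b-nonterminal = proj₁ (proj₂ sc)
    E-ab : E G a b ≡ true
    E-ab = proj₁ (proj₂ (proj₂ sc))
    deg-b≡2 : deg G b ≡ 2
    deg-b≡2 = proj₁ (proj₂ (proj₂ (proj₂ sc)))
    side : (E G b s ≡ true × Dist2 G b t) ⊎ (E G b t ≡ true × Dist2 G b s)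
    side = proj₂ (proj₂ (proj₂ (proj₂ sc)))

    a≢s : a ≢ s
    a≢s = proj₁ a-nonterminal
    a≢t : a ≢ t
    a≢t = proj₂ a-nonterminal
    b≢s : b ≢ s
    b≢s = proj₁ b-nonterminal
    b≢t : b ≢ t
    b≢t = proj₂ b-nonterminal
    E-ba : E G b a ≡ true
    E-ba = E-sym G E-ab
    a≢b : a ≢ b
    a≢b = E⇒≢ G E-ab
    b≢a : b ≢ a
    b≢a = a≢b ∘ ≡.sym

  b-neighbours : ∀ {y v} → E G b y ≡ true → y ≢ a → E G b v ≡ true → v ≡ y ⊎ v ≡ a
  b-neighbours E-by y≢a = deg-2-neighbours G deg-b≡2 E-by E-ba y≢a

  terminal-neighbour : ∃ λ x → E G b x ≡ true × x ≢ a
  terminal-neighbour = Sum.[ (λ (E-bs , _) → s , E-bs , a≢s ∘ ≡.sym) , (λ (E-bt , _) → t , E-bt , a≢t ∘ ≡.sym) ]′ side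

  shorted-a-b⇒connected : ∀ {σ} → σ a ≡ shorted → σ b ≡ shorted → Conn σ t
  shorted-a-b⇒connected {σ} σa σb with side
  ... | inj₁ (E-bs , _ , _ , y , E-by , E-yt) with b-neighbours E-bs (a≢s ∘ ≡.sym) E-by
  ...   | inj₁ refl = step here (inj₁ refl) E-yt
  ...   | inj₂ refl = step (step (step here (inj₁ refl) (E-sym G E-bs)) (inj₂ σb) E-ba) (inj₂ σa) E-yt
  shorted-a-b⇒connected {σ} σa σb | inj₂ (E-bt , _ , _ , y , E-by , E-ys) with b-neighbours E-bt (a≢t ∘ ≡.sym) E-by
  ...   | inj₁ refl = step here (inj₁ refl) (E-sym G E-ys)
  ...   | inj₂ refl = step (step (step here (inj₁ refl) (E-sym G E-ys)) (inj₂ σa) E-ab) (inj₂ σb) E-bt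

  bypass-b : ∀ {σ ρ} → σ a ≢ shorted → (∀ v → v ≢ b → σ v ≡ shorted → ρ v ≡ shorted) → Conn σ t → Conn ρ t
  bypass-b {σ} {ρ} σa≢shorted keep c = at-t (reach c)
    where
    x : Fin n
    x = proj₁ terminal-neighbour
    E-bx : E G b x ≡ true
    E-bx = proj₁ (proj₂ terminal-neighbour)
    x≢a : x ≢ a
    x≢a = proj₂ (proj₂ terminal-neighbour)

    a-blocks : ¬ (a ≡ s ⊎ σ a ≡ shorted)
    a-blocks = Sum.[ a≢s , σa≢shorted ]′

    Reached : Fin n → Set
    Reached v = v ≡ a ⊎ (v ≡ b × Conn ρ x) ⊎ (v ≢ b × Conn ρ v)

    reach : ∀ {v} → Conn σ v → Reached v
    reach here = inj₂ (inj₂ (b≢s ∘ ≡.sym , here))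
    reach (step {u} {v} c ok e) with reach c
    ... | inj₁ refl = ⊥-elim (a-blocks ok)
    ... | inj₂ (inj₁ (refl , ρx)) with b-neighbours E-bx x≢a e
    ...   | inj₁ refl = inj₂ (inj₂ (E⇒≢ G E-bx ∘ ≡.sym , ρx))
    ...   | inj₂ refl = inj₁ refl
    reach (step {u} {v} c ok e) | inj₂ (inj₂ (u≢b , ρu)) with v ≟ b
    ...   | no v≢b   = inj₂ (inj₂ (v≢b , step ρu (Sum.map₂ (keep u u≢b) ok) e))
    ...   | yes refl with b-neighbours E-bx x≢a (E-sym G e)
    ...     | inj₁ refl = inj₂ (inj₁ (refl , ρu))
    ...     | inj₂ refl = ⊥-elim (a-blocks ok)

    at-t : Reached t → Conn ρ t
    at-t (inj₁ t≡a)             = ⊥-elim (a≢t (≡.sym t≡a))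
    at-t (inj₂ (inj₁ (t≡b , _))) = ⊥-elim (b≢t (≡.sym t≡b))
    at-t (inj₂ (inj₂ (_ , ρt)))  = ρt

  reduce : State n → State n
  reduce σ = (σ [ a ↦ shorted ]) [ b ↦ cutv ]

  -- Pointwise τ ≗ reduce σ, as a relation along which Cut's strategy from τ can be followed.
  record Reduction (τ σ : State n) : Set where
    field
      τa≡shorted : τ a ≡ shorted
      τb≡cut     : τ b ≡ cutv
      σa≡free    : σ a ≡ free
      σb≡free    : σ b ≡ free
      agree      : ∀ v → v ≢ a → v ≢ b → τ v ≡ σ v

  reduce-Reduction : ∀ {σ} → σ a ≡ free → σ b ≡ free → Reduction (reduce σ) σ
  reduce-Reduction {σ} σa≡free σb≡free = record
    { τa≡shorted = trans ([↦]-other (σ [ a ↦ shorted ]) cutv a≢b) ([↦]-same σ a shorted)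
    ; τb≡cut     = [↦]-same (σ [ a ↦ shorted ]) b cutv
    ; σa≡free    = σa≡free
    ; σb≡free    = σb≡free
    ; agree      = λ v v≢a v≢b → [↦]-other² σ shorted cutv v≢a v≢b
    }

  Reduction-≗ : ∀ {τ σ} → Reduction τ σ → ∀ v → τ v ≡ reduce σ v
  Reduction-≗ R v with v ≟ b | v ≟ a
  ... | yes refl | _        = Reduction.τb≡cut R
  ... | no _     | yes refl = Reduction.τa≡shorted R
  ... | no v≢b   | no v≢a   = Reduction.agree R v v≢a v≢b

  Reduction-play : ∀ {τ σ u} p → Reduction τ σ → u ≢ a → u ≢ b → Reduction (play p u τ) (play p u σ)
  Reduction-play {τ} {σ} {u} p R u≢a u≢b = record
    { τa≡shorted = trans ([↦]-other τ (mark p) (u≢a ∘ ≡.sym)) τa≡shorted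
    ; τb≡cut     = trans ([↦]-other τ (mark p) (u≢b ∘ ≡.sym)) τb≡cut
    ; σa≡free    = trans ([↦]-other σ (mark p) (u≢a ∘ ≡.sym)) σa≡free
    ; σb≡free    = trans ([↦]-other σ (mark p) (u≢b ∘ ≡.sym)) σb≡free
    ; agree      = λ v v≢a v≢b → [↦]-cong τ σ (mark p) (agree v v≢a v≢b)
    }
    where open Reduction R

  cut-wins-whatever-b : ∀ {q τ ρ} → ρ a ≡ cutv → τ b ≢ free → ρ b ≢ free → (∀ v → v ≢ a → v ≢ b → τ v ≡ ρ v) →
                        Wins G s t cut q τ → Wins G s t cut q ρ
  cut-wins-whatever-b {τ = τ} {ρ} ρa≡cut τb≢free ρb≢free agree = simulate transfer related
    where
    open Simulation G G s t cut (_≡ b) τ ρ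

    related : Related τ ρ
    related v with v ≟ b | v ≟ a
    ... | yes refl | _        = inj₂ (refl , τb≢free , ρb≢free)
    ... | no _     | yes refl = inj₁ (won ρa≡cut)
    ... | no v≢b   | no v≢a   = inj₁ (same (agree v v≢a v≢b))

    transfer : OutcomeTransfer
    transfer {σ′} {ρ′} _ ρ⊑ρ′ r ¬c c = ¬c (bypass-b ρ′a≢shorted keep c)
      where
      ρ′a≢shorted : ρ′ a ≢ shorted
      ρ′a≢shorted rewrite ρ⊑ρ′ a (λ ρa≡free → mark≢free cut (trans (≡.sym ρa≡cut) ρa≡free)) | ρa≡cut = λ ()
      keep : ∀ v → v ≢ b → ρ′ v ≡ shorted → σ′ v ≡ shorted
      keep v v≢b with r v
      ... | inj₁ σ′v≼ρ′v  = ≼-cut σ′v≼ρ′v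
      ... | inj₂ (v≡b , _) = ⊥-elim (v≢b v≡b)

  mutual
    cut-wins-unreduce : ∀ {p τ σ} → Reduction τ σ → Wins G s t cut p τ → Wins G s t cut p σ
    cut-wins-unreduce R (mine v (nt , τv≡free) d) =
      mine v (nt , trans (≡.sym (agree v v≢a v≢b)) τv≡free) (cut-wins-unreduce (Reduction-play cut R v≢a v≢b) d)
      where
      open Reduction R
      v≢a : v ≢ a
      v≢a refl = mark≢free short (trans (≡.sym τa≡shorted) τv≡free)
      v≢b : v ≢ b
      v≢b refl = mark≢free cut (trans (≡.sym τb≡cut) τv≡free)
    cut-wins-unreduce {cut} {τ} {σ} R d@(done finished _) =
      mine a (a-nonterminal , σa≡free) (theirs (b , b-nonterminal , trans ([↦]-other σ cutv b≢a) σb≡free) only-b)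
      where
      open Reduction R
      σ₁ : State n
      σ₁ = play cut a σ
      only-b : ∀ y → Move σ₁ y → Wins G s t cut cut (play short y σ₁)
      only-b y (nt , σ₁y≡free) with y ≟ b | y ≟ a
      ... | yes refl | _        = cut-wins-whatever-b
        (trans ([↦]-other σ₁ shorted a≢b) ([↦]-same σ a cutv)) (mark≢free cut ∘ trans (≡.sym τb≡cut))
        (mark≢free short ∘ trans (≡.sym ([↦]-same σ₁ b shorted)))
        (λ v v≢a v≢b → trans (agree v v≢a v≢b) (≡.sym ([↦]-other² σ cutv shorted v≢a v≢b))) d
      ... | no _     | yes refl = ⊥-elim (mark≢free cut σ₁y≡free)
      ... | no y≢b   | no y≢a   =
        ⊥-elim (finished y (nt , trans (agree y y≢a y≢b) σ₁y≡free))
    cut-wins-unreduce {short} R d = theirs (a , a-nonterminal , Reduction.σa≡free R) (answer R d)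

    answer : ∀ {τ σ} → Reduction τ σ → Wins G s t cut short τ → ∀ y → Move σ y → Wins G s t cut cut (play short y σ)
    answer {τ} {σ} R d y (nt , σy≡free) with y ≟ a | y ≟ b
    ... | yes refl | _        = mine b (b-nonterminal , trans ([↦]-other σ shorted b≢a) σb≡free) (wins-≗ (Reduction-≗ R) d)
      where open Reduction R
    ... | no _     | yes refl = mine a (a-nonterminal , trans ([↦]-other σ shorted a≢b) σa≡free)
      (cut-wins-whatever-b ([↦]-same σ₁ a cutv) (mark≢free cut ∘ trans (≡.sym τb≡cut))
        (mark≢free short ∘ trans (≡.sym (trans ([↦]-other σ₁ cutv b≢a) ([↦]-same σ b shorted))))
        (λ v v≢a v≢b → trans (agree v v≢a v≢b) (≡.sym ([↦]-other² σ shorted cutv v≢b v≢a))) d)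
      where
      open Reduction R
      σ₁ : State n
      σ₁ = play short b σ
    ... | no y≢a   | no y≢b   = continue d
      where
      τy≡free : τ y ≡ free
      τy≡free = trans (Reduction.agree R y y≢a y≢b) σy≡free
      continue : Wins G s t cut short τ → Wins G s t cut cut (play short y σ)
      continue (done finished _) = ⊥-elim (finished y (nt , τy≡free))
      continue (theirs _ g)      = cut-wins-unreduce (Reduction-play short R y≢a y≢b) (g y (nt , τy≡free))

  short-wins-reduce : ∀ {p σ} → σ a ≡ free → σ b ≡ free → Wins G s t short p σ → Wins G s t short p (reduce σ)
  short-wins-reduce {p} {σ} σa≡free σb≡free d with short-or-cut p (reduce σ)
  ... | inj₁ d′ = d′
  ... | inj₂ c  = ⊥-elim (¬both-win d (cut-wins-unreduce (reduce-Reduction σa≡free σb≡free) c))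

  short-first-wins-unreduce : ∀ {σ} → σ a ≡ free → σ b ≡ free →
                              Wins G s t short short (reduce σ) → Wins G s t short short σ
  short-first-wins-unreduce {σ} σa≡free σb≡free d =
    mine a (a-nonterminal , σa≡free) (theirs (b , b-nonterminal , σ₁b≡free) reply)
    where
    σ₁ : State n
    σ₁ = play short a σ
    σ₁b≡free : σ₁ b ≡ free
    σ₁b≡free = trans ([↦]-other σ shorted b≢a) σb≡free
    reply : ∀ y → Move σ₁ y → Wins G s t short short (play cut y σ₁)
    reply y (_ , σ₁y≡free) with y ≟ b
    ... | yes refl = d
    ... | no y≢b   = mine b (b-nonterminal , trans ([↦]-other σ₁ cutv (y≢b ∘ ≡.sym)) σ₁b≡free)
      (connected⇒short-wins (shorted-a-b⇒connected
        (trans ([↦]-other σ₂ shorted a≢b) (trans ([↦]-other σ₁ cutv a≢y) ([↦]-same σ a shorted)))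
        ([↦]-same σ₂ b shorted)))
      where
      σ₂ : State n
      σ₂ = play cut y σ₁
      a≢y : a ≢ y
      a≢y refl = mark≢free short (trans (≡.sym ([↦]-same σ a shorted)) σ₁y≡free)

  -- With b cut in R, Short's strategy from R never uses the edge ab.
  short-first-wins-without-ab :
    Wins G s t short cut (reduced a b) → Wins (deleteEdge G a b) s t short short initial
  short-first-wins-without-ab d = mine a (a-nonterminal , refl) (simulate transfer related d)
    where
    open Simulation G (deleteEdge G a b) s t short (λ _ → ⊥) (reduced a b) (play short a initial)

    related : Related (reduced a b) (play short a initial)
    related v with v ≟ b
    ... | yes refl = inj₁ (lost refl)
    ... | no _     = inj₁ (same refl)

    transfer : OutcomeTransfer
    transfer {σ} {ρ} R⊑σ _ r c = Play.Conn-mono (deleteEdge G a b) s t keep (Conn-deleteEdge G b≢s b≢t σb≢shorted c)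
      where
      σb≢shorted : σ b ≢ shorted
      σb≢shorted rewrite R⊑σ b (mark≢free cut ∘ trans (≡.sym ([↦]-same (play short a initial) b cutv)))
                       | [↦]-same (play short a initial) b cutv = λ ()
      keep : ∀ v → σ v ≡ shorted → ρ v ≡ shorted
      keep v with r v
      ... | inj₁ σv≼ρv = ≼-short σv≼ρv

  short-wins-reduced⇔ : ∀ p →
    (MinimalWeakLink G s t ⊎ MinimalStrongLink G s t) ⊎ (WeakLink G s t × p ≡ short) ⊎ SecondPlayerWins G s t →
    Wins G s t short p initial ⇔ Wins G s t short p (reduced a b)
  short-wins-reduced⇔ short _   = mk⇔ (short-wins-reduce refl refl) (short-first-wins-unreduce refl refl)
  short-wins-reduced⇔ cut   hyp = mk⇔ (short-wins-reduce refl refl) (unreduce hyp)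
    where
    unreduce : (MinimalWeakLink G s t ⊎ MinimalStrongLink G s t) ⊎ (WeakLink G s t × cut ≡ short) ⊎ SecondPlayerWins G s t →
               Wins G s t short cut (reduced a b) → Wins G s t short cut initial
    unreduce (inj₁ (inj₁ (_ , minimal)))  d = ⊥-elim (minimal a b E-ab (short-first-wins-without-ab d))
    unreduce (inj₁ (inj₂ (strong , _)))   _ = strong
    unreduce (inj₂ (inj₁ (_ , ())))
    unreduce (inj₂ (inj₂ (inj₁ strong)))  _ = strong
    unreduce (inj₂ (inj₂ (inj₂ cut-wins))) d =
      ⊥-elim (¬both-win (short-first-wins-unreduce refl refl (extra-move d)) cut-wins)

theorem6 : ∀ {n} (G : Graph n) (s t a b : Fin n) → s ≢ t → ShortCut G s t a b →
    (p : Player) →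
    ((MinimalWeakLink G s t ⊎ MinimalStrongLink G s t) ⊎ (WeakLink G s t × p ≡ short) ⊎ SecondPlayerWins G s t) →
    (w : Player) → Wins G s t w p initial ⇔ Wins G s t w p (reduced a b)
theorem6 G s t a b _ sc p hyp short = ShortCutGame.short-wins-reduced⇔ G sc p hyp
theorem6 G s t a b _ sc p hyp cut   = Play.⇔-for-cut G s t (ShortCutGame.short-wins-reduced⇔ G sc p hyp)
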